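{- For integers $1\le k\le n$, $$W^{(\ell)}_{n,k}\!\left(\frac{4x}{(1+x)^2}\right)=\frac{\mathfrak{WB}_{n,k}(x)}{2^{k-1}(1+x)^{n-k+1}}.$$
   Context: $\mathfrak{S}_n$ is the symmetric group on $[n]$; for $\sigma\in\mathfrak{S}_n$ with convention $\sigma(0)=0$, $\mathrm{lpeak}_k(\sigma)=|\{k\le i\le n-k:\sigma(i-k)<\sigma(i)>\sigma(i+k)\}|$ (number of width-$k$ left peaks), and $W^{(\ell)}_{n,k}(x)=\sum_{\sigma\in\mathfrak{S}_n}x^{\mathrm{lpeak}_k(\sigma)}$. $B_n$ is the set of signed permutations of $[n]$ (bijections $\pi$ of $\{\pm1,\dots,\pm n\}$ with $\pi(-i)=-\pi(i)$), with $\pi(0)=0$; $\mathrm{des}_k^B(\pi)=|\{0\le i\le n-k:\pi(i)>\pi(i+k)\}|$ and $\mathfrak{WB}_{n,k}(x)=\sum_{\pi\in B_n}x^{\mathrm{des}_k^B(\pi)}$. -}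

module Defs where

open import Data.Nat as ℕ using (ℕ; zero; suc; _∸_)
open import Data.Integer as ℤ using (ℤ; +_; -_; ∣_∣)
open import Data.Rational as ℚ using (ℚ; 0ℚ; 1ℚ; _≟_; 1/_; ≢-nonZero)
open import Data.List using (List; []; _∷_; map; concatMap; filter; length; foldr; upTo)
open import Data.Bool using (Bool; true; false; _∧_; not; if_then_else_)
open import Relation.Nullary using (¬_)
open import Relation.Nullary.Decidable using (⌊_⌋)
open import Relation.Binary.PropositionalEquality using (_≡_)

words : {A : Set} → ℕ → List A → List (List A)
words zero    as = [] ∷ []
words (suc n) as = concatMap (λ a → map (a ∷_) (words n as)) as

notIn : ℕ → List ℕ → Bool
notIn m []       = true
notIn m (y ∷ ys) = not ⌊ m ℕ.≟ y ⌋ ∧ notIn m ys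

distinct : List ℕ → Bool
distinct []       = true
distinct (y ∷ ys) = notIn y ys ∧ distinct ys

oneTo : ℕ → List ℕ
oneTo n = map suc (upTo n)

-- 𝔖_n : permutations of [n] in one-line notation σ(1)…σ(n)
-- (words of length n over [n] with pairwise distinct entries)
perms : ℕ → List (List ℤ)
perms n = map (map +_) (filter (λ w → Data.Bool.T? (distinct w)) (words n (oneTo n)))
  where import Data.Bool

-- B_n : signed permutations π(1)…π(n), entries in {±1,…,±n}
-- with |π(1)|,…,|π(n)| pairwise distinct
signedPerms : ℕ → List (List ℤ)
signedPerms n =
  filter (λ w → Data.Bool.T? (distinct (map ∣_∣ w)))
         (words n (map +_ (oneTo n) Data.List.++ map (λ i → - (+ i)) (oneTo n)))
  where import Data.Bool; import Data.List

-- value at position i, with the convention π(0) = 0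
at : List ℤ → ℕ → ℤ
at w zero = + 0
at w (suc i) = nth w i
  where
  nth : List ℤ → ℕ → ℤ
  nth []       _       = + 0
  nth (a ∷ as) zero    = a
  nth (a ∷ as) (suc j) = nth as j

countI : ℕ → (ℕ → Bool) → ℕ
countI n p = length (filter (λ i → Data.Bool.T? (p i)) (upTo (suc n)))
  where import Data.Bool

ltB : ℤ → ℤ → Bool
ltB a b = ⌊ a ℤ.<? b ⌋

lpeak : ℕ → ℕ → List ℤ → ℕ
lpeak n k σ = countI n (λ i →
  ⌊ k ℕ.≤? i ⌋ ∧ ⌊ i ℕ.≤? n ∸ k ⌋ ∧
  ltB (at σ (i ∸ k)) (at σ i) ∧ ltB (at σ (i ℕ.+ k)) (at σ i))

desB : ℕ → ℕ → List ℤ → ℕ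
desB n k π = countI n (λ i →
  ⌊ i ℕ.≤? n ∸ k ⌋ ∧ ltB (at π (i ℕ.+ k)) (at π i))

_^ℚ_ : ℚ → ℕ → ℚ
q ^ℚ zero  = 1ℚ
q ^ℚ suc m = q ℚ.* (q ^ℚ m)

sumℚ : List ℚ → ℚ
sumℚ = foldr ℚ._+_ 0ℚ

Wl : ℕ → ℕ → ℚ → ℚ
Wl n k x = sumℚ (map (λ σ → x ^ℚ lpeak n k σ) (perms n))

WB : ℕ → ℕ → ℚ → ℚ
WB n k x = sumℚ (map (λ π → x ^ℚ desB n k π) (signedPerms n))

subst4 : (x : ℚ) → ¬ (1ℚ ℚ.+ x ≡ 0ℚ) → ℚ
subst4 x h = ((+ 4) ℚ./ 1) ℚ.* x ℚ.* (inv ^ℚ 2)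
  where inv = 1/_ (1ℚ ℚ.+ x) {{≢-nonZero h}}

rhs : ℕ → ℕ → (x : ℚ) → ¬ (1ℚ ℚ.+ x ≡ 0ℚ) → ℚ
rhs n k x h = WB n k x ℚ.* (ℚ.½ ^ℚ (k ∸ 1)) ℚ.* (inv ^ℚ (suc (n ∸ k)))
  where inv = 1/_ (1ℚ ℚ.+ x) {{≢-nonZero h}}

-- A signed permutation is a permutation w together with a choice of signs.
-- The pair of positions (i, i + k) is a descent iff its endpoint of larger
-- absolute value is at i and positive, or at i + k and negative; so every
-- descent is charged to that endpoint. A position j is the larger endpoint of
-- its right pair (aboveRight j) and/or of its left pair (aboveLeft j), and it is
-- charged its right pair if positive and its left pair if negative. Summing over
-- the signs therefore factorises as ∏_j (x^[aboveRight j] + x^[aboveLeft j]).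
-- Each of the n - k + 1 pairs has exactly one larger endpoint, and the width-k
-- left peaks of w are the positions that are the larger endpoint of both their
-- pairs. Dividing by (1 + x)^(n-k+1), the factors become 2, 1, 1 or
-- 2x/(1+x)^2 = t/2 with t = 4x/(1+x)^2, and the product is 2^(k-1) t^lpeak(w).

module Submission where

open import Defs
open import Data.Nat using (ℕ; _≤_)
open import Data.Rational using (ℚ; 0ℚ; 1ℚ; _+_)
open import Relation.Nullary using (¬_)
open import Relation.Binary.PropositionalEquality using (_≡_)

open import Algebra.Bundles using (CommutativeMonoid)
import Algebra.Properties.CommutativeSemigroup as CommSemigroupProperties
open import Data.Bool using (Bool; true; false; _∧_; not; if_then_else_; T; T?)
open import Data.Bool.Properties using (if-eta; T-≡; ∧-zeroʳ; ∧-identityʳ; ∧-conicalˡ; ∧-conicalʳ)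
open import Data.Empty using (⊥-elim)
open import Data.Integer as ℤ using (ℤ; -_; ∣_∣)
open import Data.List using (List; []; _∷_; map; concatMap; filter; length; _++_; applyUpTo)
open import Data.List.Membership.Propositional using (_∈_; find)
open import Data.List.Membership.Propositional.Properties using (∈-map⁻; ∈-concatMap⁻)
open import Data.List.Properties using (map-∘)
open import Data.List.Relation.Unary.All using (All; []; _∷_)
open import Data.List.Relation.Unary.Any using (here; there)
open import Data.Nat as ℕ using (zero; suc; _∸_; _<_; _<ᵇ_; _≤ᵇ_; z≤n; s≤s; z<s; s<s)
import Data.Nat.Properties as ℕₚ
open import Data.Product using (_×_; _,_)
open import Data.Rational as ℚ using (_*_; ½; 1/_; ≢-nonZero)
import Data.Rational.Properties as ℚₚ
open import Data.Rational.Solver using (module +-*-Solver)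
open import Function using (_∘_; Equivalence)
open import Relation.Binary.PropositionalEquality
  using (refl; sym; trans; cong; cong₂; subst; _≢_; module ≡-Reasoning)
open import Relation.Nullary using (yes; no)
open import Relation.Nullary.Decidable using (⌊_⌋; isYes≗does)

private
  variable
    A B : Set

  module ℕ+ = CommSemigroupProperties ℕₚ.+-commutativeSemigroup
  module ℚ+ = CommSemigroupProperties (CommutativeMonoid.commutativeSemigroup ℚₚ.+-0-commutativeMonoid)
  module ℚ* = CommSemigroupProperties (CommutativeMonoid.commutativeSemigroup ℚₚ.*-1-commutativeMonoid)

-- Sums over lists and words

sumℚ-++ : (f : A → ℚ) (xs ys : List A) →
  sumℚ (map f (xs ++ ys)) ≡ sumℚ (map f xs) + sumℚ (map f ys)
sumℚ-++ f []       ys = sym (ℚₚ.+-identityˡ _)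
sumℚ-++ f (a ∷ xs) ys = trans (cong (f a +_) (sumℚ-++ f xs ys)) (sym (ℚₚ.+-assoc (f a) _ _))

sumℚ-map : (f : B → ℚ) (g : A → B) (xs : List A) →
  sumℚ (map f (map g xs)) ≡ sumℚ (map (f ∘ g) xs)
sumℚ-map f g xs = cong sumℚ (sym (map-∘ xs))

sumℚ-concatMap : (f : B → ℚ) (g : A → List B) (xs : List A) →
  sumℚ (map f (concatMap g xs)) ≡ sumℚ (map (λ a → sumℚ (map f (g a))) xs)
sumℚ-concatMap f g []       = refl
sumℚ-concatMap f g (a ∷ xs) =
  trans (sumℚ-++ f (g a) (concatMap g xs)) (cong (sumℚ (map f (g a)) +_) (sumℚ-concatMap f g xs))

sumℚ-filter : (f : A → ℚ) (P : A → Bool) (xs : List A) →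
  sumℚ (map f (filter (T? ∘ P) xs)) ≡ sumℚ (map (λ a → if P a then f a else 0ℚ) xs)
sumℚ-filter f P []       = refl
sumℚ-filter f P (a ∷ xs) with P a
... | true  = cong (f a +_) (sumℚ-filter f P xs)
... | false = trans (sumℚ-filter f P xs) (sym (ℚₚ.+-identityˡ _))

sumℚ-cong : {f g : A → ℚ} (xs : List A) → (∀ {a} → a ∈ xs → f a ≡ g a) →
  sumℚ (map f xs) ≡ sumℚ (map g xs)
sumℚ-cong []       eq = refl
sumℚ-cong (a ∷ xs) eq = cong₂ _+_ (eq (here refl)) (sumℚ-cong xs (eq ∘ there))

sumℚ-zero : (xs : List A) → sumℚ (map (λ _ → 0ℚ) xs) ≡ 0ℚ
sumℚ-zero []       = refl
sumℚ-zero (a ∷ xs) = trans (ℚₚ.+-identityˡ _) (sumℚ-zero xs)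

sumℚ-if : (b : Bool) (f : A → ℚ) (xs : List A) →
  sumℚ (map (λ a → if b then f a else 0ℚ) xs) ≡ (if b then sumℚ (map f xs) else 0ℚ)
sumℚ-if true  f xs = refl
sumℚ-if false f xs = sumℚ-zero xs

sumℚ-+ : (f g : A → ℚ) (xs : List A) →
  sumℚ (map (λ a → f a + g a) xs) ≡ sumℚ (map f xs) + sumℚ (map g xs)
sumℚ-+ f g []       = refl
sumℚ-+ f g (a ∷ xs) = trans (cong (f a + g a +_) (sumℚ-+ f g xs))
  (ℚ+.interchange (f a) (g a) (sumℚ (map f xs)) (sumℚ (map g xs)))

sumℚ-*ˡ : (c : ℚ) (f : A → ℚ) (xs : List A) →
  c * sumℚ (map f xs) ≡ sumℚ (map (λ a → c * f a) xs)
sumℚ-*ˡ c f []       = ℚₚ.*-zeroʳ c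
sumℚ-*ˡ c f (a ∷ xs) = trans (ℚₚ.*-distribˡ-+ c (f a) _) (cong (c * f a +_) (sumℚ-*ˡ c f xs))

sumℚ-*ʳ : (c : ℚ) (f : A → ℚ) (xs : List A) →
  sumℚ (map f xs) * c ≡ sumℚ (map (λ a → f a * c) xs)
sumℚ-*ʳ c f []       = ℚₚ.*-zeroˡ c
sumℚ-*ʳ c f (a ∷ xs) = trans (ℚₚ.*-distribʳ-+ c (f a) _) (cong (f a * c +_) (sumℚ-*ʳ c f xs))

sumℚ-words-suc : (f : List A → ℚ) (m : ℕ) (L : List A) →
  sumℚ (map f (words (suc m) L)) ≡ sumℚ (map (λ a → sumℚ (map (f ∘ (a ∷_)) (words m L))) L)
sumℚ-words-suc f m L = trans (sumℚ-concatMap f (λ a → map (a ∷_) (words m L)) L)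
  (sumℚ-cong L (λ {a} _ → sumℚ-map f (a ∷_) (words m L)))

∈-words⁻ : ∀ m (L : List A) {w} → w ∈ words m L → length w ≡ m × All (_∈ L) w
∈-words⁻ zero    L (here refl) = refl , []
∈-words⁻ (suc m) L w∈ with find (∈-concatMap⁻ (λ a → map (a ∷_) (words m L)) {L} w∈)
... | a , a∈L , w∈a∷ with ∈-map⁻ (a ∷_) w∈a∷
...   | v , v∈ , refl with ∈-words⁻ m L v∈
...     | |v|≡m , v⊆L = cong suc |v|≡m , a∈L ∷ v⊆L

nthOr : A → List A → ℕ → A
nthOr d []       _       = d
nthOr d (a ∷ as) zero    = a
nthOr d (a ∷ as) (suc j) = nthOr d as j

bools : List Bool
bools = true ∷ false ∷ []

-- Missing signs default to true; only sign words of full length occur below.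
tag : (Bool → A → B) → List A → List Bool → List B
tag σ []      _       = []
tag σ (a ∷ w) []      = σ true a ∷ tag σ w []
tag σ (a ∷ w) (b ∷ s) = σ b a ∷ tag σ w s

sumℚ-words-tag : {A B : Set} (σ : Bool → A → B) (F : List B → ℚ) (m : ℕ) (L : List A) →
  sumℚ (map F (words m (map (σ true) L ++ map (σ false) L))) ≡
  sumℚ (map (λ w → sumℚ (map (F ∘ tag σ w) (words m bools))) (words m L))
sumℚ-words-tag σ F zero    L = sym (ℚₚ.+-identityʳ _)
sumℚ-words-tag {A} {B} σ F (suc m) L = begin
    sumℚ (map F (words (suc m) L±))
  ≡⟨ sumℚ-words-suc F m L± ⟩
    sumℚ (map (λ b → sumℚ (map (F ∘ (b ∷_)) (words m L±))) L±)
  ≡⟨ sumℚ-cong L± (λ {b} _ → sumℚ-words-tag σ (F ∘ (b ∷_)) m L) ⟩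
    sumℚ (map G L±)
  ≡⟨ sumℚ-++ G (map (σ true) L) (map (σ false) L) ⟩
    sumℚ (map G (map (σ true) L)) + sumℚ (map G (map (σ false) L))
  ≡⟨ cong₂ _+_ (sumℚ-map G (σ true) L) (sumℚ-map G (σ false) L) ⟩
    sumℚ (map (G ∘ σ true) L) + sumℚ (map (G ∘ σ false) L)
  ≡⟨ sym (sumℚ-+ (G ∘ σ true) (G ∘ σ false) L) ⟩
    sumℚ (map (λ l → G (σ true l) + G (σ false l)) L)
  ≡⟨ sumℚ-cong L (λ {l} _ → sym (sumℚ-+ (H l true) (H l false) (words m L))) ⟩
    sumℚ (map (λ l → sumℚ (map (λ w → H l true w + H l false w) (words m L))) L)
  ≡⟨ sumℚ-cong L (λ {l} _ → sumℚ-cong (words m L) (λ {w} _ → sym (signs-suc l w))) ⟩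
    sumℚ (map (λ l → sumℚ (map (λ w → S (l ∷ w)) (words m L))) L)
  ≡⟨ sym (sumℚ-words-suc S m L) ⟩
    sumℚ (map S (words (suc m) L))
  ∎
  where
  open ≡-Reasoning
  L± = map (σ true) L ++ map (σ false) L
  G : B → ℚ
  G b = sumℚ (map (λ w → sumℚ (map (F ∘ (b ∷_) ∘ tag σ w) (words m bools))) (words m L))
  H : A → Bool → List A → ℚ
  H l b w = sumℚ (map (F ∘ (σ b l ∷_) ∘ tag σ w) (words m bools))
  S : List A → ℚ
  S w = sumℚ (map (F ∘ tag σ w) (words (suc m) bools))
  signs-suc : (l : A) (w : List A) → S (l ∷ w) ≡ H l true w + H l false w
  signs-suc l w = trans (sumℚ-words-suc (F ∘ tag σ (l ∷ w)) m bools)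
    (cong (H l true w +_) (ℚₚ.+-identityʳ _))

-- Indicators, and sums and products over ranges

𝟙 : Bool → ℕ
𝟙 true  = 1
𝟙 false = 0

∑< : ℕ → (ℕ → ℕ) → ℕ
∑< zero    f = 0
∑< (suc n) f = f 0 ℕ.+ ∑< n (f ∘ suc)

infix 30 ∑<
syntax ∑< n (λ i → e) = ∑[ i < n ] e

∑-cong : ∀ n {f g : ℕ → ℕ} → (∀ {i} → i < n → f i ≡ g i) → ∑< n f ≡ ∑< n g
∑-cong zero    eq = refl
∑-cong (suc n) eq = cong₂ ℕ._+_ (eq z<s) (∑-cong n (eq ∘ s<s))

∑-+ : ∀ n (f g : ℕ → ℕ) → ∑[ i < n ] (f i ℕ.+ g i) ≡ ∑< n f ℕ.+ ∑< n g
∑-+ zero    f g = refl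
∑-+ (suc n) f g = trans (cong (f 0 ℕ.+ g 0 ℕ.+_) (∑-+ n (f ∘ suc) (g ∘ suc)))
  (ℕ+.interchange (f 0) (g 0) (∑< n (f ∘ suc)) (∑< n (g ∘ suc)))

∑-split : ∀ m n (f : ℕ → ℕ) → ∑< (m ℕ.+ n) f ≡ ∑< m f ℕ.+ ∑[ i < n ] f (m ℕ.+ i)
∑-split zero    n f = refl
∑-split (suc m) n f = trans (cong (f 0 ℕ.+_) (∑-split m n (f ∘ suc))) (sym (ℕₚ.+-assoc (f 0) _ _))

∑-vanish : ∀ n {f : ℕ → ℕ} → (∀ {i} → i < n → f i ≡ 0) → ∑< n f ≡ 0
∑-vanish zero    eq = refl
∑-vanish (suc n) eq = cong₂ ℕ._+_ (eq z<s) (∑-vanish n (eq ∘ s<s))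

∑-ones : ∀ n → ∑[ i < n ] 1 ≡ n
∑-ones zero    = refl
∑-ones (suc n) = cong suc (∑-ones n)

length-filter-applyUpTo : (p : ℕ → Bool) (g : ℕ → ℕ) (m : ℕ) →
  length (filter (T? ∘ p) (applyUpTo g m)) ≡ ∑[ i < m ] 𝟙 (p (g i))
length-filter-applyUpTo p g zero = refl
length-filter-applyUpTo p g (suc m) with p (g 0)
... | true  = cong suc (length-filter-applyUpTo p (g ∘ suc) m)
... | false = length-filter-applyUpTo p (g ∘ suc) m

countI≡∑ : (n : ℕ) (p : ℕ → Bool) → countI n p ≡ ∑[ i < suc n ] 𝟙 (p i)
countI≡∑ n p = length-filter-applyUpTo p (λ i → i) (suc n)

∏< : ℕ → (ℕ → ℚ) → ℚ
∏< zero    f = 1ℚ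
∏< (suc n) f = f 0 * ∏< n (f ∘ suc)

infix 30 ∏<
syntax ∏< n (λ i → e) = ∏[ i < n ] e

∏-cong : ∀ n {f g : ℕ → ℚ} → (∀ {i} → i < n → f i ≡ g i) → ∏< n f ≡ ∏< n g
∏-cong zero    eq = refl
∏-cong (suc n) eq = cong₂ _*_ (eq z<s) (∏-cong n (eq ∘ s<s))

∏-* : ∀ n (f g : ℕ → ℚ) → ∏[ i < n ] (f i * g i) ≡ ∏< n f * ∏< n g
∏-* zero    f g = sym (ℚₚ.*-identityˡ 1ℚ)
∏-* (suc n) f g = trans (cong (f 0 * g 0 *_) (∏-* n (f ∘ suc) (g ∘ suc)))
  (ℚ*.interchange (f 0) (g 0) (∏< n (f ∘ suc)) (∏< n (g ∘ suc)))

^ℚ-+ : (q : ℚ) (a b : ℕ) → q ^ℚ (a ℕ.+ b) ≡ q ^ℚ a * q ^ℚ b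
^ℚ-+ q zero    b = sym (ℚₚ.*-identityˡ _)
^ℚ-+ q (suc a) b = trans (cong (q *_) (^ℚ-+ q a b)) (sym (ℚₚ.*-assoc q _ _))

∏-^ℚ : ∀ n (q : ℚ) (c : ℕ → ℕ) → ∏[ i < n ] (q ^ℚ c i) ≡ q ^ℚ ∑< n c
∏-^ℚ zero    q c = refl
∏-^ℚ (suc n) q c = trans (cong (q ^ℚ c 0 *_) (∏-^ℚ n q (c ∘ suc))) (sym (^ℚ-+ q (c 0) _))

∏-const : ∀ n (q : ℚ) → ∏[ i < n ] q ≡ q ^ℚ n
∏-const zero    q = refl
∏-const (suc n) q = cong (q *_) (∏-const n q)

sumℚ-words-∏ : {A : Set} (d : A) (L : List A) (f : ℕ → A → ℚ) (m : ℕ) →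
  sumℚ (map (λ s → ∏[ j < m ] f j (nthOr d s j)) (words m L)) ≡ ∏[ j < m ] sumℚ (map (f j) L)
sumℚ-words-∏ d L f zero    = ℚₚ.+-identityʳ 1ℚ
sumℚ-words-∏ {A} d L f (suc m) = begin
    sumℚ (map (λ s → ∏[ j < suc m ] f j (nthOr d s j)) (words (suc m) L))
  ≡⟨ sumℚ-words-suc _ m L ⟩
    sumℚ (map (λ a → sumℚ (map (λ s → f 0 a * P s) (words m L))) L)
  ≡⟨ sumℚ-cong L (λ {a} _ → sym (sumℚ-*ˡ (f 0 a) P (words m L))) ⟩
    sumℚ (map (λ a → f 0 a * sumℚ (map P (words m L))) L)
  ≡⟨ sumℚ-cong L (λ {a} _ → cong (f 0 a *_) (sumℚ-words-∏ d L (f ∘ suc) m)) ⟩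
    sumℚ (map (λ a → f 0 a * ∏[ j < m ] sumℚ (map (f (suc j)) L)) L)
  ≡⟨ sym (sumℚ-*ʳ _ (f 0) L) ⟩
    sumℚ (map (f 0) L) * ∏[ j < m ] sumℚ (map (f (suc j)) L)
  ∎
  where
  open ≡-Reasoning
  P : List A → ℚ
  P s = ∏[ j < m ] f (suc j) (nthOr d s j)

<ᵇ-flip : ∀ a b → a ≢ b → (a <ᵇ b) ≡ not (b <ᵇ a)
<ᵇ-flip zero    zero    a≢b = ⊥-elim (a≢b refl)
<ᵇ-flip zero    (suc b) a≢b = refl
<ᵇ-flip (suc a) zero    a≢b = refl
<ᵇ-flip (suc a) (suc b) a≢b = <ᵇ-flip a b (a≢b ∘ cong suc)

if-true-false : ∀ c → c ≡ (if c then true else false)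
if-true-false true  = refl
if-true-false false = refl

not≡if : ∀ c → not c ≡ (if c then false else true)
not≡if true  = refl
not≡if false = refl

≤ᵇ-true : ∀ {m n} → m ≤ n → (m ≤ᵇ n) ≡ true
≤ᵇ-true = Equivalence.to T-≡ ∘ ℕₚ.≤⇒≤ᵇ

≤ᵇ-false : ∀ {m n} → n < m → (m ≤ᵇ n) ≡ false
≤ᵇ-false {suc m}       {zero}  _         = refl
≤ᵇ-false {suc (suc m)} {suc n} (s≤s n<m) = ≤ᵇ-false n<m

∑-𝟙≤ᵇ : ∀ r m → ∑[ i < suc r ℕ.+ m ] 𝟙 (i ≤ᵇ r) ≡ suc r
∑-𝟙≤ᵇ r m = begin
    ∑[ i < suc r ℕ.+ m ] 𝟙 (i ≤ᵇ r)
  ≡⟨ ∑-split (suc r) m (λ i → 𝟙 (i ≤ᵇ r)) ⟩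
    ∑[ i < suc r ] 𝟙 (i ≤ᵇ r) ℕ.+ ∑[ i < m ] 𝟙 (suc r ℕ.+ i ≤ᵇ r)
  ≡⟨ cong₂ ℕ._+_ (∑-cong (suc r) (λ { (s≤s i≤r) → cong 𝟙 (≤ᵇ-true i≤r) }))
                 (∑-vanish m (λ {i} _ → cong 𝟙 (≤ᵇ-false (s≤s (ℕₚ.m≤m+n r i))))) ⟩
    ∑[ i < suc r ] 1 ℕ.+ 0
  ≡⟨ cong (ℕ._+ 0) (∑-ones (suc r)) ⟩
    suc r ℕ.+ 0
  ≡⟨ ℕₚ.+-identityʳ (suc r) ⟩
    suc r
  ∎
  where open ≡-Reasoning

𝟙-∧-if : (g c α β X : Bool) → (T g → X ≡ (if c then α else β)) →
  𝟙 (g ∧ X) ≡ 𝟙 (g ∧ c) ℕ.* 𝟙 α ℕ.+ 𝟙 (g ∧ not c) ℕ.* 𝟙 β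
𝟙-∧-if false c     α     β     X _  = refl
𝟙-∧-if true  true  true  β     X eq = cong 𝟙 (eq _)
𝟙-∧-if true  true  false β     X eq = cong 𝟙 (eq _)
𝟙-∧-if true  false α     true  X eq = cong 𝟙 (eq _)
𝟙-∧-if true  false α     false X eq = cong 𝟙 (eq _)

𝟙-if : (b p q : Bool) → 𝟙 p ℕ.* 𝟙 b ℕ.+ 𝟙 q ℕ.* 𝟙 (not b) ≡ 𝟙 (if b then p else q)
𝟙-if true  p q = trans (cong₂ ℕ._+_ (ℕₚ.*-identityʳ (𝟙 p)) (ℕₚ.*-zeroʳ (𝟙 q))) (ℕₚ.+-identityʳ (𝟙 p))
𝟙-if false p q = trans (cong (ℕ._+ 𝟙 q ℕ.* 1) (ℕₚ.*-zeroʳ (𝟙 p))) (ℕₚ.*-identityʳ (𝟙 q))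

𝟙-∧-split : (g c : Bool) → 𝟙 (g ∧ c) ℕ.+ 𝟙 (g ∧ not c) ≡ 𝟙 g
𝟙-∧-split false c     = refl
𝟙-∧-split true  true  = refl
𝟙-∧-split true  false = refl

∧-interchange : (a b c d : Bool) → a ∧ b ∧ c ∧ d ≡ (b ∧ d) ∧ (a ∧ c)
∧-interchange false b     c     d = sym (∧-zeroʳ (b ∧ d))
∧-interchange true  false c     d = refl
∧-interchange true  true  false d = sym (∧-zeroʳ d)
∧-interchange true  true  true  d = sym (∧-identityʳ d)

+-∸-suc : ∀ m r → m ℕ.+ suc r ∸ suc m ≡ r
+-∸-suc m r = trans (cong (_∸ suc m) (ℕₚ.+-suc m r)) (ℕₚ.m+n∸m≡n m r)

+-suc-comm : ∀ m n → m ℕ.+ suc n ≡ n ℕ.+ suc m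
+-suc-comm m n = trans (ℕₚ.+-suc m n) (trans (cong suc (ℕₚ.+-comm m n)) (sym (ℕₚ.+-suc n m)))

-- The substitution t = 4x/(1+x)²

two : ℚ
two = 1ℚ + 1ℚ

½^*2^≡1 : ∀ m → ½ ^ℚ m * two ^ℚ m ≡ 1ℚ
½^*2^≡1 zero    = refl
½^*2^≡1 (suc m) = trans
  (ℚ*.interchange ½ (½ ^ℚ m) two (two ^ℚ m))
  (cong (½ * two *_) (½^*2^≡1 m))

module Substitution (x inv : ℚ) (inverse : (1ℚ + x) * inv ≡ 1ℚ) where

  t : ℚ
  t = (ℤ.+ 4) ℚ./ 1 * x * inv ^ℚ 2

  weight-pair : (a b : Bool) →
    (x ^ℚ 𝟙 a + x ^ℚ 𝟙 b) * inv ^ℚ (𝟙 a ℕ.+ 𝟙 b) ≡ two * t ^ℚ 𝟙 (a ∧ b) * ½ ^ℚ (𝟙 a ℕ.+ 𝟙 b)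
  weight-pair true  true  =
    solve 2 (λ x i → (x :* con 1ℚ :+ x :* con 1ℚ) :* (i :* (i :* con 1ℚ))
                   := con two :* ((con ((ℤ.+ 4) ℚ./ 1) :* x :* (i :* (i :* con 1ℚ))) :* con 1ℚ)
                              :* (con ½ :* (con ½ :* con 1ℚ)))
      refl x inv
    where open +-*-Solver
  weight-pair true  false = trans
    (solve 2 (λ x i → (x :* con 1ℚ :+ con 1ℚ) :* (i :* con 1ℚ) := (con 1ℚ :+ x) :* i) refl x inv) inverse
    where open +-*-Solver
  weight-pair false true  = trans
    (solve 2 (λ x i → (con 1ℚ :+ x :* con 1ℚ) :* (i :* con 1ℚ) := (con 1ℚ :+ x) :* i) refl x inv) inverse
    where open +-*-Solver
  weight-pair false false = refl

  weight-∏ : ∀ k' r (a b : ℕ → Bool) →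
    ∑[ j < k' ℕ.+ suc r ] (𝟙 (a j) ℕ.+ 𝟙 (b j)) ≡ suc r →
    ∏[ j < k' ℕ.+ suc r ] (x ^ℚ 𝟙 (a j) + x ^ℚ 𝟙 (b j)) * ½ ^ℚ k' * inv ^ℚ suc r ≡
    t ^ℚ ∑[ j < k' ℕ.+ suc r ] 𝟙 (a j ∧ b j)
  weight-∏ k' r a b ∑c≡ = begin
      ∏< n f * ½ ^ℚ k' * inv ^ℚ suc r
    ≡⟨ solve 3 (λ p h i → p :* h :* i := p :* i :* h) refl (∏< n f) (½ ^ℚ k') (inv ^ℚ suc r) ⟩
      ∏< n f * inv ^ℚ suc r * ½ ^ℚ k'
    ≡⟨ cong (λ e → ∏< n f * inv ^ℚ e * ½ ^ℚ k') (sym ∑c≡) ⟩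
      ∏< n f * inv ^ℚ ∑< n c * ½ ^ℚ k'
    ≡⟨ cong (λ e → ∏< n f * e * ½ ^ℚ k') (sym (∏-^ℚ n inv c)) ⟩
      ∏< n f * ∏[ j < n ] (inv ^ℚ c j) * ½ ^ℚ k'
    ≡⟨ cong (_* ½ ^ℚ k') (sym (∏-* n f (λ j → inv ^ℚ c j))) ⟩
      ∏[ j < n ] (f j * inv ^ℚ c j) * ½ ^ℚ k'
    ≡⟨ cong (_* ½ ^ℚ k') (∏-cong n (λ {j} _ → weight-pair (a j) (b j))) ⟩
      ∏[ j < n ] (two * t ^ℚ p j * ½ ^ℚ c j) * ½ ^ℚ k'
    ≡⟨ cong (_* ½ ^ℚ k') ∏-factors ⟩
      two ^ℚ n * t ^ℚ ∑< n p * ½ ^ℚ suc r * ½ ^ℚ k'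
    ≡⟨ solve 4 (λ a b c d → a :* b :* c :* d := b :* ((c :* d) :* a)) refl
         (two ^ℚ n) (t ^ℚ ∑< n p) (½ ^ℚ suc r) (½ ^ℚ k') ⟩
      t ^ℚ ∑< n p * (½ ^ℚ suc r * ½ ^ℚ k' * two ^ℚ n)
    ≡⟨ cong (λ e → t ^ℚ ∑< n p * (e * two ^ℚ n))
            (trans (sym (^ℚ-+ ½ (suc r) k')) (cong (½ ^ℚ_) (ℕₚ.+-comm (suc r) k'))) ⟩
      t ^ℚ ∑< n p * (½ ^ℚ n * two ^ℚ n)
    ≡⟨ trans (cong (t ^ℚ ∑< n p *_) (½^*2^≡1 n)) (ℚₚ.*-identityʳ _) ⟩
      t ^ℚ ∑< n p
    ∎
    where
    open ≡-Reasoning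
    open +-*-Solver
    n = k' ℕ.+ suc r
    f : ℕ → ℚ
    f j = x ^ℚ 𝟙 (a j) + x ^ℚ 𝟙 (b j)
    c p : ℕ → ℕ
    c j = 𝟙 (a j) ℕ.+ 𝟙 (b j)
    p j = 𝟙 (a j ∧ b j)
    ∏-factors : ∏[ j < n ] (two * t ^ℚ p j * ½ ^ℚ c j) ≡ two ^ℚ n * t ^ℚ ∑< n p * ½ ^ℚ suc r
    ∏-factors = begin
        ∏[ j < n ] (two * t ^ℚ p j * ½ ^ℚ c j)
      ≡⟨ ∏-* n (λ j → two * t ^ℚ p j) (λ j → ½ ^ℚ c j) ⟩
        ∏[ j < n ] (two * t ^ℚ p j) * ∏[ j < n ] (½ ^ℚ c j)
      ≡⟨ cong₂ _*_ (∏-* n (λ _ → two) (λ j → t ^ℚ p j)) (∏-^ℚ n ½ c) ⟩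
        ∏[ j < n ] two * ∏[ j < n ] (t ^ℚ p j) * ½ ^ℚ ∑< n c
      ≡⟨ cong₂ (λ u v → u * v * ½ ^ℚ ∑< n c) (∏-const n two) (∏-^ℚ n t p) ⟩
        two ^ℚ n * t ^ℚ ∑< n p * ½ ^ℚ ∑< n c
      ≡⟨ cong (λ e → two ^ℚ n * t ^ℚ ∑< n p * ½ ^ℚ e) ∑c≡ ⟩
        two ^ℚ n * t ^ℚ ∑< n p * ½ ^ℚ suc r
      ∎

-- Signed words

sign : Bool → ℕ → ℤ
sign true  a = ℤ.+ a
sign false a = - (ℤ.+ a)

signed : List ℕ → List Bool → List ℤ
signed = tag sign

val : List ℕ → ℕ → ℕ
val w = nthOr 0 (0 ∷ w)

at-positive : (w : List ℕ) (i : ℕ) → at (map (sign true) w) i ≡ ℤ.+ val w i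
at-positive w       zero          = refl
at-positive []      (suc i)       = refl
at-positive (a ∷ w) (suc zero)    = refl
at-positive (a ∷ w) (suc (suc i)) = at-positive w (suc i)

sign-zero : (b : Bool) → ℤ.+ 0 ≡ sign b 0
sign-zero true  = refl
sign-zero false = refl

at-signed : (w : List ℕ) (s : List Bool) (i : ℕ) → at (signed w s) i ≡ sign (nthOr true s (i ∸ 1)) (val w i)
at-signed w       s       zero          = sign-zero (nthOr true s 0)
at-signed []      s       (suc i)       = sign-zero (nthOr true s i)
at-signed (a ∷ w) []      (suc zero)    = refl
at-signed (a ∷ w) []      (suc (suc i)) = at-signed w [] (suc i)
at-signed (a ∷ w) (b ∷ s) (suc zero)    = refl
at-signed (a ∷ w) (b ∷ s) (suc (suc i)) = at-signed w s (suc i)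

∣signed∣ : (w : List ℕ) (s : List Bool) → map ∣_∣ (signed w s) ≡ w
∣signed∣ []            s           = refl
∣signed∣ (a ∷ w)       []          = cong (a ∷_) (∣signed∣ w [])
∣signed∣ (a ∷ w)       (true ∷ s)  = cong (a ∷_) (∣signed∣ w s)
∣signed∣ (zero ∷ w)    (false ∷ s) = cong (0 ∷_) (∣signed∣ w s)
∣signed∣ (suc a ∷ w)   (false ∷ s) = cong (suc a ∷_) (∣signed∣ w s)

ltB-sign : (α β : Bool) (a b : ℕ) → a ≢ b → ltB (sign β b) (sign α a) ≡ (if b <ᵇ a then α else not β)
ltB-sign true  true  a       b       _   = trans (isYes≗does _) (if-true-false (b <ᵇ a))
ltB-sign false true  zero    b       _   = refl
ltB-sign false true  (suc a) b       _   = sym (if-eta (b <ᵇ suc a))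
ltB-sign true  false zero    zero    a≢b = ⊥-elim (a≢b refl)
ltB-sign true  false (suc a) zero    _   = refl
ltB-sign true  false a       (suc b) _   = sym (if-eta (suc b <ᵇ a))
ltB-sign false false zero    zero    a≢b = ⊥-elim (a≢b refl)
ltB-sign false false (suc a) zero    _   = refl
ltB-sign false false zero    (suc b) _   = refl
ltB-sign false false (suc a) (suc b) a≢b =
  trans (isYes≗does _) (trans (<ᵇ-flip a b (a≢b ∘ cong suc)) (not≡if (b <ᵇ a)))

-- Descents of the signings and left peaks of a fixed word

module Statistics (w : List ℕ) (k' r : ℕ)
                  (apart : ∀ {i} → i ≤ r → val w i ≢ val w (i ℕ.+ suc k')) where

  k n : ℕ
  k = suc k'
  n = k' ℕ.+ suc r

  aboveRight belowRight aboveLeft : ℕ → Bool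
  aboveRight i = (i ≤ᵇ r) ∧ (val w (i ℕ.+ k) <ᵇ val w i)
  belowRight i = (i ≤ᵇ r) ∧ not (val w (i ℕ.+ k) <ᵇ val w i)
  aboveLeft  i = (k ≤ᵇ i) ∧ (val w (i ∸ k) <ᵇ val w i)

  aboveLeft-false : ∀ {i} → i < k → aboveLeft i ≡ false
  aboveLeft-false {i} i<k = cong (_∧ (val w (i ∸ k) <ᵇ val w i)) (≤ᵇ-false i<k)

  belowRight-false : ∀ {i} → r < i → belowRight i ≡ false
  belowRight-false {i} r<i = cong (_∧ not (val w (i ℕ.+ k) <ᵇ val w i)) (≤ᵇ-false r<i)

  aboveLeft≡belowRight : ∀ {i} → i ≤ r → aboveLeft (suc (k' ℕ.+ i)) ≡ belowRight i
  aboveLeft≡belowRight {i} i≤r = begin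
      (k ≤ᵇ suc (k' ℕ.+ i)) ∧ (val w (k' ℕ.+ i ∸ k') <ᵇ val w (suc (k' ℕ.+ i)))
    ≡⟨ cong₂ (λ b j → b ∧ (val w j <ᵇ val w (suc (k' ℕ.+ i))))
             (≤ᵇ-true (s≤s (ℕₚ.m≤m+n k' i))) (ℕₚ.m+n∸m≡n k' i) ⟩
      val w i <ᵇ val w (suc (k' ℕ.+ i))
    ≡⟨ cong (λ j → val w i <ᵇ val w j) (trans (cong suc (ℕₚ.+-comm k' i)) (sym (ℕₚ.+-suc i k'))) ⟩
      val w i <ᵇ val w (i ℕ.+ k)
    ≡⟨ <ᵇ-flip (val w i) (val w (i ℕ.+ k)) (apart i≤r) ⟩
      not (val w (i ℕ.+ k) <ᵇ val w i)
    ≡⟨ cong (_∧ not (val w (i ℕ.+ k) <ᵇ val w i)) (sym (≤ᵇ-true i≤r)) ⟩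
      belowRight i
    ∎
    where open ≡-Reasoning

  ∑-aboveRight+aboveLeftLeft : (v : ℕ → ℕ) →
    ∑[ j < n ] (𝟙 (aboveLeft (suc j)) ℕ.* v j) ≡ ∑[ i < suc n ] (𝟙 (belowRight i) ℕ.* v (i ℕ.+ k'))
  ∑-aboveRight+aboveLeftLeft v = begin
      ∑< (k' ℕ.+ suc r) f
    ≡⟨ ∑-split k' (suc r) f ⟩
      ∑< k' f ℕ.+ ∑[ i < suc r ] f (k' ℕ.+ i)
    ≡⟨ cong₂ ℕ._+_ (∑-vanish k' (λ {j} j<k' → cong (λ b → 𝟙 b ℕ.* v j) (aboveLeft-false (s≤s j<k'))))
                   (∑-cong (suc r) (λ { {i} (s≤s i≤r) →
                     cong₂ (λ b j → 𝟙 b ℕ.* v j) (aboveLeft≡belowRight i≤r) (ℕₚ.+-comm k' i) })) ⟩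
      ∑< (suc r) g
    ≡⟨ sym (ℕₚ.+-identityʳ _) ⟩
      ∑< (suc r) g ℕ.+ 0
    ≡⟨ cong (∑< (suc r) g ℕ.+_) (sym (∑-vanish k (λ {i} _ →
         cong (λ b → 𝟙 b ℕ.* v (suc r ℕ.+ i ℕ.+ k')) (belowRight-false (s≤s (ℕₚ.m≤m+n r i)))))) ⟩
      ∑< (suc r) g ℕ.+ ∑[ i < k ] g (suc r ℕ.+ i)
    ≡⟨ sym (∑-split (suc r) k g) ⟩
      ∑< (suc r ℕ.+ k) g
    ≡⟨ cong (λ m → ∑< (suc m) g) (+-suc-comm r k') ⟩
      ∑< (suc n) g
    ∎
    where
    open ≡-Reasoning
    f g : ℕ → ℕ
    f j = 𝟙 (aboveLeft (suc j)) ℕ.* v j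
    g i = 𝟙 (belowRight i) ℕ.* v (i ℕ.+ k')

  descentAt : (s : List Bool) (i : ℕ) →
    𝟙 (⌊ i ℕ.≤? n ∸ k ⌋ ∧ ltB (at (signed w s) (i ℕ.+ k)) (at (signed w s) i)) ≡
    𝟙 (aboveRight i) ℕ.* 𝟙 (nthOr true s (i ∸ 1)) ℕ.+ 𝟙 (belowRight i) ℕ.* 𝟙 (not (nthOr true s (i ℕ.+ k')))
  descentAt s i = begin
      𝟙 (⌊ i ℕ.≤? n ∸ k ⌋ ∧ ltB (at (signed w s) (i ℕ.+ k)) (at (signed w s) i))
    ≡⟨ cong₂ (λ b X → 𝟙 (b ∧ X)) (trans (isYes≗does (i ℕ.≤? n ∸ k)) (cong (i ≤ᵇ_) (+-∸-suc k' r)))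
                                 (cong₂ ltB (at-signed w s (i ℕ.+ k)) (at-signed w s i)) ⟩
      𝟙 ((i ≤ᵇ r) ∧ ltB (sign (σ ((i ℕ.+ k) ∸ 1)) (val w (i ℕ.+ k))) (sign (σ (i ∸ 1)) (val w i)))
    ≡⟨ 𝟙-∧-if (i ≤ᵇ r) _ (σ (i ∸ 1)) _ _ (λ i≤r → ltB-sign _ _ _ _ (apart (ℕₚ.≤ᵇ⇒≤ i r i≤r))) ⟩
      𝟙 (aboveRight i) ℕ.* 𝟙 (σ (i ∸ 1)) ℕ.+ 𝟙 (belowRight i) ℕ.* 𝟙 (not (σ ((i ℕ.+ k) ∸ 1)))
    ≡⟨ cong (λ j → 𝟙 (aboveRight i) ℕ.* 𝟙 (σ (i ∸ 1)) ℕ.+ 𝟙 (belowRight i) ℕ.* 𝟙 (not (σ j)))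
            (cong (_∸ 1) (ℕₚ.+-suc i k')) ⟩
      𝟙 (aboveRight i) ℕ.* 𝟙 (σ (i ∸ 1)) ℕ.+ 𝟙 (belowRight i) ℕ.* 𝟙 (not (σ (i ℕ.+ k')))
    ∎
    where
    open ≡-Reasoning
    σ = nthOr true s

  -- Position 0 carries the value 0, so aboveRight 0 is false and the i = 0 terms vanish.
  desB-signed : (s : List Bool) →
    desB n k (signed w s) ≡ ∑[ j < n ] 𝟙 (if nthOr true s j then aboveRight (suc j) else aboveLeft (suc j))
  desB-signed s = begin
      desB n k (signed w s)
    ≡⟨ countI≡∑ n isDescent ⟩
      ∑[ i < suc n ] 𝟙 (isDescent i)
    ≡⟨ ∑-cong (suc n) (λ {i} _ → descentAt s i) ⟩
      ∑[ i < suc n ] (R i ℕ.+ R′ i)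
    ≡⟨ ∑-+ (suc n) R R′ ⟩
      ∑[ j < n ] R (suc j) ℕ.+ ∑< (suc n) R′
    ≡⟨ cong (∑[ j < n ] R (suc j) ℕ.+_) (sym (∑-aboveRight+aboveLeftLeft (𝟙 ∘ not ∘ σ))) ⟩
      ∑[ j < n ] R (suc j) ℕ.+ ∑< n L
    ≡⟨ sym (∑-+ n (R ∘ suc) L) ⟩
      ∑[ j < n ] (R (suc j) ℕ.+ L j)
    ≡⟨ ∑-cong n (λ {j} _ → 𝟙-if (σ j) (aboveRight (suc j)) (aboveLeft (suc j))) ⟩
      ∑[ j < n ] 𝟙 (if σ j then aboveRight (suc j) else aboveLeft (suc j))
    ∎
    where
    open ≡-Reasoning
    σ = nthOr true s
    isDescent : ℕ → Bool
    isDescent i = ⌊ i ℕ.≤? n ∸ k ⌋ ∧ ltB (at (signed w s) (i ℕ.+ k)) (at (signed w s) i)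
    R R′ L : ℕ → ℕ
    R i = 𝟙 (aboveRight i) ℕ.* 𝟙 (σ (i ∸ 1))
    R′ i = 𝟙 (belowRight i) ℕ.* 𝟙 (not (σ (i ℕ.+ k')))
    L j = 𝟙 (aboveLeft (suc j)) ℕ.* 𝟙 (not (σ j))

  lpeak-positive : lpeak n k (map (sign true) w) ≡ ∑[ j < n ] 𝟙 (aboveRight (suc j) ∧ aboveLeft (suc j))
  lpeak-positive = trans (countI≡∑ n isPeak) (∑-cong (suc n) (λ {i} _ → cong 𝟙 (peakAt i)))
    where
    isPeak : ℕ → Bool
    isPeak i = ⌊ k ℕ.≤? i ⌋ ∧ ⌊ i ℕ.≤? n ∸ k ⌋ ∧ ltB (at σ (i ∸ k)) (at σ i) ∧ ltB (at σ (i ℕ.+ k)) (at σ i)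
      where σ = map (sign true) w
    peakAt : ∀ i → isPeak i ≡ aboveRight i ∧ aboveLeft i
    peakAt i rewrite isYes≗does (k ℕ.≤? i) | isYes≗does (i ℕ.≤? n ∸ k) | (+-∸-suc k' r)
                   | at-positive w (i ∸ k) | at-positive w i | at-positive w (i ℕ.+ k)
                   | isYes≗does (ℤ.+ val w (i ∸ k) ℤ.<? ℤ.+ val w i)
                   | isYes≗does (ℤ.+ val w (i ℕ.+ k) ℤ.<? ℤ.+ val w i) =
      ∧-interchange (k ≤ᵇ i) (i ≤ᵇ r) (val w (i ∸ k) <ᵇ val w i) (val w (i ℕ.+ k) <ᵇ val w i)

  ∑-aboveRight+aboveLeft : ∑[ j < n ] (𝟙 (aboveRight (suc j)) ℕ.+ 𝟙 (aboveLeft (suc j))) ≡ suc r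
  ∑-aboveRight+aboveLeft = begin
      ∑[ j < n ] (R (suc j) ℕ.+ L (suc j))
    ≡⟨ ∑-+ n (R ∘ suc) (L ∘ suc) ⟩
      ∑[ j < n ] R (suc j) ℕ.+ ∑[ j < n ] L (suc j)
    ≡⟨ cong (∑[ j < n ] R (suc j) ℕ.+_)
            (trans (∑-cong n (λ {j} _ → sym (ℕₚ.*-identityʳ (L (suc j))))) (∑-aboveRight+aboveLeftLeft (λ _ → 1))) ⟩
      ∑< (suc n) R ℕ.+ ∑[ i < suc n ] (R′ i ℕ.* 1)
    ≡⟨ cong (∑< (suc n) R ℕ.+_) (∑-cong (suc n) (λ {i} _ → ℕₚ.*-identityʳ (R′ i))) ⟩
      ∑< (suc n) R ℕ.+ ∑< (suc n) R′
    ≡⟨ sym (∑-+ (suc n) R R′) ⟩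
      ∑[ i < suc n ] (R i ℕ.+ R′ i)
    ≡⟨ ∑-cong (suc n) (λ {i} _ → 𝟙-∧-split (i ≤ᵇ r) (val w (i ℕ.+ k) <ᵇ val w i)) ⟩
      ∑[ i < suc n ] 𝟙 (i ≤ᵇ r)
    ≡⟨ cong (λ m → ∑[ i < suc m ] 𝟙 (i ≤ᵇ r)) (sym (+-suc-comm r k')) ⟩
      ∑[ i < suc r ℕ.+ k ] 𝟙 (i ≤ᵇ r)
    ≡⟨ ∑-𝟙≤ᵇ r k ⟩
      suc r
    ∎
    where
    open ≡-Reasoning
    R R′ L : ℕ → ℕ
    R = 𝟙 ∘ aboveRight
    R′ = 𝟙 ∘ belowRight
    L = 𝟙 ∘ aboveLeft

-- Permutations

notIn⇒≢ : ∀ {m} ys {j} → notIn m ys ≡ true → j < length ys → m ≢ nthOr 0 ys j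
notIn⇒≢ {m} (y ∷ ys) {j} m∉ j< with m ℕ.≟ y
notIn⇒≢ (y ∷ ys) {j}     () j<       | yes _
notIn⇒≢ (y ∷ ys) {zero}  m∉ j<       | no m≢y = m≢y
notIn⇒≢ (y ∷ ys) {suc j} m∉ (s≤s j<) | no _   = notIn⇒≢ ys m∉ j<

distinct⇒≢ : ∀ ys {i j} → distinct ys ≡ true → i < j → j < length ys → nthOr 0 ys i ≢ nthOr 0 ys j
distinct⇒≢ (y ∷ ys) {zero}  {suc j} dis _         (s≤s j<) = notIn⇒≢ ys (∧-conicalˡ _ _ dis) j<
distinct⇒≢ (y ∷ ys) {suc i} {suc j} dis (s≤s i<j) (s≤s j<) = distinct⇒≢ ys (∧-conicalʳ _ _ dis) i<j j<

nthOr-All : ∀ {P : A → Set} {d} ys {j} → All P ys → j < length ys → P (nthOr d ys j)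
nthOr-All (y ∷ ys) {zero}  (py ∷ _)   _        = py
nthOr-All (y ∷ ys) {suc j} (_  ∷ pys) (s≤s j<) = nthOr-All ys pys j<

∈-oneTo⇒≢0 : ∀ {m a} → a ∈ oneTo m → a ≢ 0
∈-oneTo⇒≢0 a∈ with ∈-map⁻ suc a∈
... | _ , _ , refl = λ ()

permutation-apart : ∀ k' r {w} →
  length w ≡ k' ℕ.+ suc r → All (_∈ oneTo (k' ℕ.+ suc r)) w → distinct w ≡ true →
  ∀ {i} → i ≤ r → val w i ≢ val w (i ℕ.+ suc k')
permutation-apart k' r {w} len w⊆ dis {zero}  _ =
  ∈-oneTo⇒≢0 (nthOr-All w w⊆ (subst (k' <_) (sym len) (ℕₚ.m<m+n k' z<s))) ∘ sym
permutation-apart k' r {w} len w⊆ dis {suc i} i<r =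
  distinct⇒≢ w dis (ℕₚ.m<m+n i z<s)
    (subst (i ℕ.+ suc k' <_) (trans (+-suc-comm r k') (sym len)) (ℕₚ.+-monoˡ-< (suc k') i<r))

module Identity (k' r : ℕ) (x : ℚ) (x≢-1 : ¬ (1ℚ + x ≡ 0ℚ)) where

  k n : ℕ
  k = suc k'
  n = k' ℕ.+ suc r

  inv : ℚ
  inv = 1/_ (1ℚ + x) {{≢-nonZero x≢-1}}

  open Substitution x inv (ℚₚ.*-inverseʳ (1ℚ + x) {{≢-nonZero x≢-1}})

  scale : ℚ → ℚ
  scale q = q * ½ ^ℚ k' * inv ^ℚ suc r

  signSum : List ℕ → ℚ
  signSum w = sumℚ (map (λ s → x ^ℚ desB n k (signed w s)) (words n bools))

  permSignSum : List ℕ → ℚ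
  permSignSum w = if distinct w then signSum w else 0ℚ

  signSum-scaled : ∀ {w} → w ∈ words n (oneTo n) → distinct w ≡ true →
    scale (signSum w) ≡ t ^ℚ lpeak n k (map (sign true) w)
  signSum-scaled {w} w∈ dis with ∈-words⁻ n (oneTo n) w∈
  ... | len , w⊆ = begin
      scale (signSum w)
    ≡⟨ cong scale (sumℚ-cong (words n bools) (λ {s} _ →
         trans (cong (x ^ℚ_) (desB-signed s)) (sym (∏-^ℚ n x _)))) ⟩
      scale (sumℚ (map (λ s → ∏[ j < n ] f j (nthOr true s j)) (words n bools)))
    ≡⟨ cong scale (sumℚ-words-∏ true bools f n) ⟩
      scale (∏[ j < n ] (f j true + (f j false + 0ℚ)))
    ≡⟨ cong scale (∏-cong n (λ {j} _ → cong (λ q → f j true + q) (ℚₚ.+-identityʳ (f j false)))) ⟩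
      scale (∏[ j < n ] (f j true + f j false))
    ≡⟨ weight-∏ k' r (aboveRight ∘ suc) (aboveLeft ∘ suc) ∑-aboveRight+aboveLeft ⟩
      t ^ℚ ∑[ j < n ] 𝟙 (aboveRight (suc j) ∧ aboveLeft (suc j))
    ≡⟨ cong (t ^ℚ_) (sym lpeak-positive) ⟩
      t ^ℚ lpeak n k (map (sign true) w)
    ∎
    where
    open ≡-Reasoning
    open Statistics w k' r (permutation-apart k' r len w⊆ dis)
      using (aboveRight; aboveLeft; desB-signed; lpeak-positive; ∑-aboveRight+aboveLeft)
    f : ℕ → Bool → ℚ
    f j b = x ^ℚ 𝟙 (if b then aboveRight (suc j) else aboveLeft (suc j))

  scale-0 : scale 0ℚ ≡ 0ℚ
  scale-0 = trans (cong (_* inv ^ℚ suc r) (ℚₚ.*-zeroˡ (½ ^ℚ k'))) (ℚₚ.*-zeroˡ (inv ^ℚ suc r))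

  sumℚ-scale : (g : A → ℚ) (xs : List A) → sumℚ (map (scale ∘ g) xs) ≡ scale (sumℚ (map g xs))
  sumℚ-scale g xs = trans (sym (sumℚ-*ʳ (inv ^ℚ suc r) (λ a → g a * ½ ^ℚ k') xs))
                          (cong (_* inv ^ℚ suc r) (sym (sumℚ-*ʳ (½ ^ℚ k') g xs)))

  WB≡∑permSignSum : WB n k x ≡ sumℚ (map permSignSum (words n (oneTo n)))
  WB≡∑permSignSum = begin
      WB n k x
    ≡⟨ sumℚ-filter (λ π → x ^ℚ desB n k π) (distinct ∘ map ∣_∣) (words n O±) ⟩
      sumℚ (map F (words n O±))
    ≡⟨ sumℚ-words-tag sign F n (oneTo n) ⟩
      sumℚ (map (λ w → sumℚ (map (F ∘ signed w) (words n bools))) (words n (oneTo n)))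
    ≡⟨ sumℚ-cong (words n (oneTo n)) (λ {w} _ → sumℚ-signed w) ⟩
      sumℚ (map permSignSum (words n (oneTo n)))
    ∎
    where
    open ≡-Reasoning
    O± = map (sign true) (oneTo n) ++ map (sign false) (oneTo n)
    F : List ℤ → ℚ
    F π = if distinct (map ∣_∣ π) then x ^ℚ desB n k π else 0ℚ
    sumℚ-signed : ∀ w → sumℚ (map (F ∘ signed w) (words n bools)) ≡ permSignSum w
    sumℚ-signed w = trans
      (sumℚ-cong (words n bools) (λ {s} _ →
        cong (λ v → if distinct v then x ^ℚ desB n k (signed w s) else 0ℚ) (∣signed∣ w s)))
      (sumℚ-if (distinct w) (λ s → x ^ℚ desB n k (signed w s)) (words n bools))

  Wl≡scaled-WB : Wl n k t ≡ scale (WB n k x)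
  Wl≡scaled-WB = begin
      Wl n k t
    ≡⟨ sumℚ-map (λ σ → t ^ℚ lpeak n k σ) (map (sign true)) (filter (T? ∘ distinct) (words n (oneTo n))) ⟩
      sumℚ (map (λ w → t ^ℚ lpeak n k (map (sign true) w)) (filter (T? ∘ distinct) (words n (oneTo n))))
    ≡⟨ sumℚ-filter (λ w → t ^ℚ lpeak n k (map (sign true) w)) distinct (words n (oneTo n)) ⟩
      sumℚ (map (λ w → if distinct w then t ^ℚ lpeak n k (map (sign true) w) else 0ℚ) (words n (oneTo n)))
    ≡⟨ sumℚ-cong (words n (oneTo n)) perWord ⟩
      sumℚ (map (scale ∘ permSignSum) (words n (oneTo n)))
    ≡⟨ sumℚ-scale permSignSum (words n (oneTo n)) ⟩
      scale (sumℚ (map permSignSum (words n (oneTo n))))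
    ≡⟨ cong scale (sym WB≡∑permSignSum) ⟩
      scale (WB n k x)
    ∎
    where
    open ≡-Reasoning
    perWord : ∀ {w} → w ∈ words n (oneTo n) →
      (if distinct w then t ^ℚ lpeak n k (map (sign true) w) else 0ℚ) ≡ scale (permSignSum w)
    perWord {w} w∈ with distinct w in dis
    ... | true  = sym (signSum-scaled w∈ dis)
    ... | false = sym scale-0

  Wl≡rhs : Wl n k t ≡ rhs n k x x≢-1
  Wl≡rhs = trans Wl≡scaled-WB (cong (λ e → WB n k x * ½ ^ℚ k' * inv ^ℚ suc e) (sym (+-∸-suc k' r)))

proposition23 : (n k : ℕ) → 1 ≤ k → k ≤ n → (x : ℚ) → (h : ¬ (1ℚ + x ≡ 0ℚ)) →
    Wl n k (subst4 x h) ≡ rhs n k x h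
proposition23 n (suc k') (s≤s z≤n) k≤n x h =
  subst (λ m → Wl m (suc k') (subst4 x h) ≡ rhs m (suc k') x h)
        (trans (ℕₚ.+-suc k' (n ∸ suc k')) (ℕₚ.m+[n∸m]≡n k≤n))
        (Identity.Wl≡rhs k' (n ∸ suc k') x h)
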